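{- Let $k\ge1$ be an integer. For $n\ge0$, let $\rho_{ -k}(n)$ denote the number of partitions of $n$ in which the largest part $\lambda$ appears exactly once and the remaining parts form a $k$-coloured partition of $\lambda$. Then, as formal power series (equivalently for $|q|<1$), $$\sum_{n=0}^{\infty}\rho_{ -k}(n)q^n=\frac{1}{(q^2;q^2)_\infty^k}-\frac{kq^2}{1-q^2}-1.$$
   Context: For $|q|<1$, $(a;q)_\infty=\prod_{k=0}^{\infty}(1-aq^k)$. A $k$-coloured partition of $m$ is a partition of $m$ in which each part is given one of $k$ distinct colours (parts of equal size and equal colour are indistinguishable); their number $p_{ -k}(m)$ satisfies $\sum_{m\ge0}p_{ -k}(m)q^m=1/(q;q)_\infty^k$ (e.g. $p_{ -2}(3)=10$). Since the largest part $\lambda$ appears exactly once, all remaining parts have size strictly less than $\lambda$, and $n=2\lambda$. The empty partition has no largest part, so $\rho_{ -k}(0)=0$. -}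

module Defs where

open import Data.Nat using (ℕ; zero; suc; _+_; _<_; _≤_)
import Data.Nat
import Relation.Nullary
open import Data.Nat.DivMod using (_/_; _%_)
open import Data.Fin using (Fin; toℕ)
open import Data.Integer as ℤ using (ℤ)
open import Data.List using (List; map)
open import Data.Nat.ListAction using (sum)
open import Data.List.Relation.Unary.All using (All)
open import Data.List.Relation.Unary.Linked using (Linked)
open import Data.Product using (Σ; _×_; proj₁; _,_)
open import Data.Sum using (_⊎_)
open import Relation.Binary.PropositionalEquality using (_≡_)
open import Function.Bundles using (_↔_)

ColouredPart : ℕ → Set
ColouredPart k = ℕ × Fin k

-- Lists linked by this (non-strict) relation represent multisets of
-- coloured parts, i.e. parts of equal size and colour are indistinguishable.
_≽_ : {k : ℕ} → ColouredPart k → ColouredPart k → Set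
(a , c) ≽ (b , d) = (b < a) ⊎ ((a ≡ b) × (toℕ d ≤ toℕ c))

record ColPart (k m : ℕ) : Set where
  constructor colPart
  field
    parts    : List (ColouredPart k)
    positive : All (λ p → 1 ≤ proj₁ p) parts
    sorted   : Linked _≽_ parts
    sums     : sum (map proj₁ parts) ≡ m

-- The partitions counted by ρ_{-k}(n): a partition of n whose largest
-- part λ ≥ 1 appears exactly once, the remaining parts (all < λ) forming
-- a k-coloured partition of λ; hence n = λ + λ.
record RhoPart (k n : ℕ) : Set where
  constructor rhoPart
  field
    largest  : ℕ
    largest≥1 : 1 ≤ largest
    rest     : ColPart k largest
    restSmall : All (λ p → proj₁ p < largest) (ColPart.parts rest)
    total    : n ≡ largest + largest

HasSize : Set → ℕ → Set
HasSize A N = A ↔ Fin N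

FPS : Set
FPS = ℕ → ℤ

_⊕_ : FPS → FPS → FPS
(f ⊕ g) n = f n ℤ.+ g n

_⊖_ : FPS → FPS → FPS
(f ⊖ g) n = f n ℤ.- g n

sumTo : ℕ → (ℕ → ℤ) → ℤ
sumTo zero    h = h 0
sumTo (suc n) h = sumTo n h ℤ.+ h (suc n)

_⊛_ : FPS → FPS → FPS
(f ⊛ g) n = sumTo n (λ i → f i ℤ.* g (n Data.Nat.∸ i))

const : ℤ → FPS
const c zero    = c
const c (suc _) = ℤ.0ℤ

mono : ℕ → FPS
mono j n with j Data.Nat.≟ n
... | Relation.Nullary.yes _ = ℤ.1ℤ
... | Relation.Nullary.no  _ = ℤ.0ℤ

subst-q² : FPS → FPS
subst-q² f n with n % 2
... | zero  = f (n / 2)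
... | suc _ = ℤ.0ℤ

geom : FPS
geom _ = ℤ.1ℤ

-- A k-coloured partition of λ ≥ 1 either is the single part λ, in one of k
-- colours, or has all its parts smaller than λ; adjoining the part λ to the
-- latter gives exactly the partitions counted by ρ_{-k}(2λ).  Hence
-- ρ_{-k}(2λ) = p_{-k}(λ) - k, the coefficient of q^{2λ} on the right, while
-- at q^0 and at odd powers both sides vanish.
module Submission where

open import Defs
open import Data.Nat using (ℕ; _≤_)
open import Data.Integer using (+_)
open import Relation.Binary.PropositionalEquality using (_≡_)

open import Data.Nat using (zero; suc; _+_; _*_; _∸_; _<_; z≤n; s≤s; _≟_; ⌊_/2⌋)
open import Data.Nat.Properties
  using ( +-suc; +-identityʳ; *-comm; ≤-refl; ≤-trans; ≤-<-trans; ≤-pred; m≤n⇒m≤1+n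
        ; ≤∧≢⇒<; <-irrefl; even≢odd; m≤m+n; m≤n+m; m<m+n; m<n+m; n≡⌊n+n/2⌋
        ; ≡-irrelevant; ≤-irrelevant; <-irrelevant )
open import Data.Nat.DivMod using (m*n%n≡0; m*n/n≡m; [m+kn]%n≡m%n)
open import Data.Integer as ℤ using (ℤ; 0ℤ; _-_)
import Data.Integer.Properties as ℤₚ
open import Algebra.Bundles using (AbelianGroup)
open import Algebra.Properties.Group (AbelianGroup.group ℤₚ.+-0-abelianGroup)
  using (//-rightDividesʳ)
open import Data.Fin as Fin using (Fin)
open import Data.Fin.Properties using (+↔⊎)
open import Data.Fin.Permutation using (↔⇒≡)
open import Data.List using (List; []; _∷_; map)
open import Data.Nat.ListAction using (sum)
open import Data.List.Relation.Unary.All as All using (All; []; _∷_)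
open import Data.List.Relation.Unary.Linked as Linked using ([]; [-]; _∷_)
open import Data.Product using (Σ; proj₁; _,_)
open import Data.Sum using (_⊎_; inj₁; inj₂)
open import Data.Sum.Function.Propositional using (_⊎-↔_)
open import Data.Empty using (⊥-elim)
open import Relation.Nullary using (¬_; yes; no)
open import Relation.Binary.PropositionalEquality
  using (_≢_; refl; sym; trans; cong; cong₂; subst; module ≡-Reasoning)
open import Function.Bundles using (_↔_; Inverse; mk↔ₛ′)
open import Function.Properties.Inverse using (↔-sym; ↔-trans; ↔-refl)

private variable
  A B : Set
  k m n j L : ℕ

HasSize-unique : HasSize A m → HasSize A n → m ≡ n
HasSize-unique hm hn = ↔⇒≡ (↔-trans (↔-sym hm) hn)

HasSize-↔ : A ↔ B → HasSize B n → HasSize A n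
HasSize-↔ = ↔-trans

HasSize-⊎ : HasSize A m → HasSize B n → HasSize (A ⊎ B) (m + n)
HasSize-⊎ hA hB = ↔-trans (hA ⊎-↔ hB) (↔-sym +↔⊎)

HasSize-empty : ¬ A → HasSize A n → n ≡ 0
HasSize-empty {n = zero}  _  _ = refl
HasSize-empty {n = suc _} ¬a h = ⊥-elim (¬a (Inverse.from h Fin.zero))

2*n≡n+n : ∀ n → 2 * n ≡ n + n
2*n≡n+n n = cong (_+_ n) (+-identityʳ n)

+-self-injective : ∀ a b → a + a ≡ b + b → a ≡ b
+-self-injective a b eq = trans (n≡⌊n+n/2⌋ a) (trans (cong ⌊_/2⌋ eq) (sym (n≡⌊n+n/2⌋ b)))

+-self≢1+[+-self] : ∀ a b → a + a ≢ suc (b + b)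
+-self≢1+[+-self] a b eq =
  even≢odd a b (trans (2*n≡n+n a) (trans eq (cong suc (sym (2*n≡n+n b)))))

data Parity : ℕ → Set where
  even : ∀ a → Parity (a + a)
  odd  : ∀ a → Parity (suc (a + a))

parity : ∀ n → Parity n
parity zero = even 0
parity (suc n) with parity n
... | even a = odd a
... | odd a  = subst Parity (cong suc (+-suc a a)) (even (suc a))

+[m+n]-n≡+m : ∀ m n → + (m + n) - + n ≡ + m
+[m+n]-n≡+m m n = trans (cong (_- + n) (ℤₚ.pos-+ m n)) (//-rightDividesʳ (+ n) (+ m))

n+n≡n*2 : ∀ n → n + n ≡ n * 2
n+n≡n*2 n = trans (sym (2*n≡n+n n)) (*-comm 2 n)

subst-q²-even : ∀ f a → subst-q² f (a + a) ≡ f a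
subst-q²-even f a rewrite n+n≡n*2 a | m*n%n≡0 a 2 ⦃ _ ⦄ = cong f (m*n/n≡m a 2)

subst-q²-odd : ∀ f a → subst-q² f (suc (a + a)) ≡ 0ℤ
subst-q²-odd f a rewrite n+n≡n*2 a | [m+kn]%n≡m%n 1 a 2 ⦃ _ ⦄ = refl

SupportedAt : ℕ → FPS → Set
SupportedAt j f = ∀ i → i ≢ j → f i ≡ 0ℤ

sumTo-vanishing : ∀ n (h : ℕ → ℤ) → (∀ i → i ≤ n → h i ≡ 0ℤ) → sumTo n h ≡ 0ℤ
sumTo-vanishing zero    h h≡0 = h≡0 0 z≤n
sumTo-vanishing (suc n) h h≡0
  rewrite sumTo-vanishing n h (λ i i≤n → h≡0 i (m≤n⇒m≤1+n i≤n))
        | h≡0 (suc n) ≤-refl = refl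

sumTo-single : ∀ n (h : ℕ → ℤ) → SupportedAt j h → j ≤ n → sumTo n h ≡ h j
sumTo-single zero    h h-supp z≤n = refl
sumTo-single {j} (suc n) h h-supp j≤1+n with j ≟ suc n
... | yes refl
  rewrite sumTo-vanishing n h (λ i i≤n → h-supp i (λ { refl → <-irrefl refl (s≤s i≤n) }))
  = ℤₚ.+-identityˡ (h (suc n))
... | no j≢1+n
  rewrite sumTo-single n h h-supp (≤-pred (≤∧≢⇒< j≤1+n j≢1+n))
        | h-supp (suc n) (λ eq → j≢1+n (sym eq)) = ℤₚ.+-identityʳ (h j)

⊛-supportedˡ-below : ∀ {f} g → SupportedAt j f → n < j → (f ⊛ g) n ≡ 0ℤ
⊛-supportedˡ-below {j} {n} {f} g f-supp n<j = sumTo-vanishing n _ term≡0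
  where
  term≡0 : ∀ i → i ≤ n → f i ℤ.* g (n ∸ i) ≡ 0ℤ
  term≡0 i i≤n rewrite f-supp i (λ { refl → <-irrefl refl (≤-<-trans i≤n n<j) }) = refl

⊛-supportedˡ : ∀ {f} g → SupportedAt j f → j ≤ n → (f ⊛ g) n ≡ f j ℤ.* g (n ∸ j)
⊛-supportedˡ {j} {n} {f} g f-supp = sumTo-single n _ term≡0
  where
  term≡0 : SupportedAt j (λ i → f i ℤ.* g (n ∸ i))
  term≡0 i i≢j rewrite f-supp i i≢j = refl

const-⊛ : ∀ c f n → (const c ⊛ f) n ≡ c ℤ.* f n
const-⊛ c f n = sumTo-single n _ (λ { zero 0≢0 → ⊥-elim (0≢0 refl) ; (suc i) _ → refl }) z≤n

mono-supported : SupportedAt j (mono j)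
mono-supported {j} i i≢j with j ≟ i
... | yes refl = ⊥-elim (i≢j refl)
... | no _     = refl

mono-at : ∀ j → mono j j ≡ ℤ.1ℤ
mono-at j with j ≟ j
... | yes _   = refl
... | no j≢j  = ⊥-elim (j≢j refl)

cq^j : ℤ → ℕ → FPS
cq^j c j = const c ⊛ mono j

cq^j-supported : ∀ c j → SupportedAt j (cq^j c j)
cq^j-supported c j i i≢j
  rewrite const-⊛ c (mono j) i | mono-supported i i≢j = ℤₚ.*-zeroʳ c

cq^j-at : ∀ c j → cq^j c j j ≡ c
cq^j-at c j rewrite const-⊛ c (mono j) j | mono-at j = ℤₚ.*-identityʳ c

cq²/[1-q²] : ℤ → FPS
cq²/[1-q²] c = cq^j c 2 ⊛ subst-q² geom

cq²/[1-q²]-0 : ∀ c → cq²/[1-q²] c 0 ≡ 0ℤ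
cq²/[1-q²]-0 c = ⊛-supportedˡ-below {n = 0} (subst-q² geom) (cq^j-supported c 2) (s≤s z≤n)

cq²/[1-q²]-2+ : ∀ c m → cq²/[1-q²] c (2 + m) ≡ c ℤ.* subst-q² geom m
cq²/[1-q²]-2+ c m
  rewrite ⊛-supportedˡ {n = 2 + m} (subst-q² geom) (cq^j-supported c 2) (s≤s (s≤s z≤n))
  = cong (ℤ._* subst-q² geom m) (cq^j-at c 2)

cq²/[1-q²]-even : ∀ c a → cq²/[1-q²] c (suc a + suc a) ≡ c
cq²/[1-q²]-even c a = begin
  cq²/[1-q²] c (suc a + suc a)   ≡⟨ cong (λ n → cq²/[1-q²] c (suc n)) (+-suc a a) ⟩
  cq²/[1-q²] c (2 + (a + a))     ≡⟨ cq²/[1-q²]-2+ c (a + a) ⟩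
  c ℤ.* subst-q² geom (a + a)    ≡⟨ cong (c ℤ.*_) (subst-q²-even geom a) ⟩
  c ℤ.* ℤ.1ℤ                     ≡⟨ ℤₚ.*-identityʳ c ⟩
  c                              ∎
  where open ≡-Reasoning

cq²/[1-q²]-odd : ∀ c a → cq²/[1-q²] c (suc (a + a)) ≡ 0ℤ
cq²/[1-q²]-odd c zero    =
  ⊛-supportedˡ-below {n = 1} (subst-q² geom) (cq^j-supported c 2) (s≤s (s≤s z≤n))
cq²/[1-q²]-odd c (suc a) = begin
  cq²/[1-q²] c (suc (suc a + suc a))   ≡⟨ cong (λ n → cq²/[1-q²] c (2 + n)) (+-suc a a) ⟩
  cq²/[1-q²] c (2 + suc (a + a))       ≡⟨ cq²/[1-q²]-2+ c (suc (a + a)) ⟩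
  c ℤ.* subst-q² geom (suc (a + a))    ≡⟨ cong (c ℤ.*_) (subst-q²-odd geom a) ⟩
  c ℤ.* 0ℤ                             ≡⟨ ℤₚ.*-zeroʳ c ⟩
  0ℤ                                   ∎
  where open ≡-Reasoning

≽-irrelevant : {a b : ColouredPart k} (p q : a ≽ b) → p ≡ q
≽-irrelevant (inj₁ p)         (inj₁ q)         = cong inj₁ (<-irrelevant p q)
≽-irrelevant (inj₁ p)         (inj₂ (refl , _)) = ⊥-elim (<-irrefl refl p)
≽-irrelevant (inj₂ (refl , _)) (inj₁ q)         = ⊥-elim (<-irrefl refl q)
≽-irrelevant (inj₂ (e , p))   (inj₂ (e′ , q))  =
  cong inj₂ (cong₂ _,_ (≡-irrelevant e e′) (≤-irrelevant p q))

ColPart-≡ : (c d : ColPart k m) → ColPart.parts c ≡ ColPart.parts d → c ≡ d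
ColPart-≡ (colPart ps pos s eq) (colPart .ps pos′ s′ eq′) refl
  rewrite All.irrelevant ≤-irrelevant pos pos′
        | Linked.irrelevant ≽-irrelevant s s′
        | ≡-irrelevant eq eq′ = refl

HasSize-ColPart-0 : HasSize (ColPart k 0) 1
HasSize-ColPart-0 =
  mk↔ₛ′ (λ _ → Fin.zero) (λ _ → empty) (λ { Fin.zero → refl ; (Fin.suc ()) }) empty-unique
  where
  empty : ColPart k 0
  empty = colPart [] [] [] refl

  empty-unique : ∀ c → empty ≡ c
  empty-unique c@(colPart [] _ _ _) = ColPart-≡ empty c refl
  empty-unique (colPart ((a , _) ∷ ps) (1≤a ∷ _) _ eq) =
    ⊥-elim (<-irrefl (sym eq) (≤-trans 1≤a (m≤m+n a _)))

ColPartBelow : ℕ → ℕ → Set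
ColPartBelow k L = Σ (ColPart k L) (λ c → All (λ q → proj₁ q < L) (ColPart.parts c))

parts≤sum : (ps : List (ColouredPart k)) → All (λ q → proj₁ q ≤ sum (map proj₁ ps)) ps
parts≤sum []             = []
parts≤sum ((a , _) ∷ ps) =
  m≤m+n a _ ∷ All.map (λ q≤sum → ≤-trans q≤sum (m≤n+m _ a)) (parts≤sum ps)

parts<sum : (p q : ColouredPart k) (ps : List (ColouredPart k)) →
            All (λ r → 1 ≤ proj₁ r) (p ∷ q ∷ ps) →
            All (λ r → proj₁ r < sum (map proj₁ (p ∷ q ∷ ps))) (p ∷ q ∷ ps)
parts<sum (a , _) q@(b , _) ps (1≤a ∷ 1≤b ∷ _) =
  m<m+n a (≤-trans 1≤b (m≤m+n b _))
  ∷ All.map (λ r≤sum → ≤-<-trans r≤sum (m<n+m _ 1≤a)) (parts≤sum (q ∷ ps))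

ColPart↔Below⊎Fin : 1 ≤ L → ColPart k L ↔ (ColPartBelow k L ⊎ Fin k)
ColPart↔Below⊎Fin {L} {k} 1≤L = mk↔ₛ′ split join split∘join join∘split
  where
  single : Fin k → ColPart k L
  single col = colPart ((L , col) ∷ []) (1≤L ∷ []) [-] (+-identityʳ L)

  split : ColPart k L → ColPartBelow k L ⊎ Fin k
  split c@(colPart []               _   _ _)  = inj₁ (c , [])
  split   (colPart ((_ , col) ∷ []) _   _ _)  = inj₂ col
  split c@(colPart ps@(p ∷ q ∷ qs)  pos _ eq) =
    inj₁ (c , subst (λ m → All (λ r → proj₁ r < m) ps) eq (parts<sum p q qs pos))

  join : ColPartBelow k L ⊎ Fin k → ColPart k L
  join (inj₁ (c , _)) = c
  join (inj₂ col)     = single col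

  join∘split : ∀ c → join (split c) ≡ c
  join∘split (colPart [] _ _ _) = refl
  join∘split c@(colPart ((a , col) ∷ []) _ _ eq) =
    ColPart-≡ (single col) c (cong (λ b → (b , col) ∷ []) (trans (sym eq) (+-identityʳ a)))
  join∘split (colPart (_ ∷ _ ∷ _) _ _ _) = refl

  split∘join : ∀ x → split (join x) ≡ x
  split∘join (inj₁ (colPart [] _ _ _ , [])) = refl
  split∘join (inj₁ (colPart ((a , _) ∷ []) _ _ eq , a<L ∷ [])) =
    ⊥-elim (<-irrefl (trans (sym (+-identityʳ a)) eq) a<L)
  split∘join (inj₁ (c@(colPart (_ ∷ _ ∷ _) _ _ _) , below)) =
    cong (λ below′ → inj₁ (c , below′)) (All.irrelevant <-irrelevant _ below)
  split∘join (inj₂ _) = refl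

RhoPart↔ColPartBelow : 1 ≤ L → RhoPart k (L + L) ↔ ColPartBelow k L
RhoPart↔ColPartBelow {L} {k} 1≤L = mk↔ₛ′ to from to∘from from∘to
  where
  to : RhoPart k (L + L) → ColPartBelow k L
  to (rhoPart M _ c below total) with +-self-injective M L (sym total)
  ... | refl = c , below

  from : ColPartBelow k L → RhoPart k (L + L)
  from (c , below) = rhoPart L 1≤L c below refl

  to∘from : ∀ x → to (from x) ≡ x
  to∘from _ rewrite ≡-irrelevant (+-self-injective L L refl) refl = refl

  from∘to : ∀ r → from (to r) ≡ r
  from∘to (rhoPart M 1≤M c below total) with +-self-injective M L (sym total)
  ... | refl rewrite ≤-irrelevant 1≤L 1≤M | ≡-irrelevant total refl = refl

RhoPart-0-empty : ¬ RhoPart k 0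
RhoPart-0-empty (rhoPart λ′ 1≤λ′ _ _ total) = <-irrefl total (≤-trans 1≤λ′ (m≤m+n λ′ λ′))

RhoPart-odd-empty : ∀ a → ¬ RhoPart k (suc (a + a))
RhoPart-odd-empty a (rhoPart λ′ _ _ _ total) = +-self≢1+[+-self] λ′ a (sym total)

HasSize-ColPart : ∀ {r} → 1 ≤ L → HasSize (RhoPart k (L + L)) r → HasSize (ColPart k L) (r + k)
HasSize-ColPart 1≤L hρ = HasSize-↔ (ColPart↔Below⊎Fin 1≤L)
  (HasSize-⊎ (HasSize-↔ (↔-sym (RhoPart↔ColPartBelow 1≤L)) hρ) ↔-refl)

theorem1p4 : (k : ℕ) → 1 ≤ k →
  (ρ p : ℕ → ℕ) →
  (∀ n → HasSize (RhoPart k n) (ρ n)) →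
  (∀ m → HasSize (ColPart k m) (p m)) →
  ∀ n → + ρ n
    ≡ ((subst-q² (λ i → + p i) ⊖ ((const (+ k) ⊛ mono 2) ⊛ subst-q² geom)) ⊖ const (+ 1)) n
-- The identity holds for k = 0 as well.
theorem1p4 k _ ρ p hρ hp n = coefficient n (parity n)
  where
  P : FPS
  P i = + p i

  coefficient : ∀ n → Parity n →
                + ρ n ≡ (subst-q² P n - cq²/[1-q²] (+ k) n) - const (+ 1) n
  coefficient _ (even zero)
    rewrite HasSize-empty RhoPart-0-empty (hρ 0)
          | HasSize-unique (hp 0) HasSize-ColPart-0
          | cq²/[1-q²]-0 (+ k) = refl
  coefficient _ (odd a)
    rewrite HasSize-empty (RhoPart-odd-empty a) (hρ (suc (a + a)))
          | subst-q²-odd P a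
          | cq²/[1-q²]-odd (+ k) a = refl
  coefficient _ (even (suc a)) = begin
    + ρ (ℓ + ℓ)                                    ≡⟨ sym (+[m+n]-n≡+m (ρ (ℓ + ℓ)) k) ⟩
    + (ρ (ℓ + ℓ) + k) - + k                        ≡⟨ cong (λ m → + m - + k) (sym p[ℓ]≡ρ[2ℓ]+k) ⟩
    + p ℓ - + k                                    ≡⟨ cong₂ _-_ (sym (subst-q²-even P ℓ))
                                                                (sym (cq²/[1-q²]-even (+ k) a)) ⟩
    subst-q² P (ℓ + ℓ) - cq²/[1-q²] (+ k) (ℓ + ℓ) ≡⟨ sym (ℤₚ.+-identityʳ _) ⟩
    (subst-q² P (ℓ + ℓ) - cq²/[1-q²] (+ k) (ℓ + ℓ)) - 0ℤ ∎
    where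
    open ≡-Reasoning
    ℓ : ℕ
    ℓ = suc a
    p[ℓ]≡ρ[2ℓ]+k : p ℓ ≡ ρ (ℓ + ℓ) + k
    p[ℓ]≡ρ[2ℓ]+k = HasSize-unique (hp ℓ) (HasSize-ColPart (s≤s z≤n) (hρ (ℓ + ℓ)))
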